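{- Let $n$ be a positive integer and let $\pi=\pi_1\pi_2\ldots\pi_n$ be a permutation of $\{1,\ldots,n\}$ with inversion table $I(\pi)=(a_1,a_2,\ldots,a_n)$. Then $\pi$ is valleyless if and only if $a_k\in\{0,\,n-k\}$ for every $k=1,2,\ldots,n$.
   Context: The inversion table of a permutation $\pi=\pi_1\ldots\pi_n$ of $\{1,\ldots,n\}$ is $(a_1,\ldots,a_n)$, where $a_k$ is the number of entries of the word $\pi$ that lie to the left of the entry $k$ and are greater than $k$. A sequence $s_1,\ldots,s_n$ is valleyless if for all $1\le i<j<k\le n$ one has $s_j\ge\min\{s_i,s_k\}$. -}

module Defs where

open import Data.Nat using (ℕ; zero; suc; _∸_; _≤_)
open import Data.Fin using (Fin; toℕ; _<_; _<?_)
open import Data.Fin.Permutation using (Permutation′; _⟨$⟩ʳ_; _⟨$⟩ˡ_)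
open import Data.List using (List; length; filter; allFin)
open import Data.Product using (_×_)
open import Data.Sum using (_⊎_)
open import Relation.Binary.PropositionalEquality using (_≡_)
open import Relation.Nullary.Decidable using (_×-dec_)

-- Conventions: positions and values are 0-indexed, i.e. Fin n stands for
-- {1,…,n} via i ↦ i+1.  A permutation π is the word π(0) π(1) … π(n-1),
-- where π(i) = π ⟨$⟩ʳ i is the entry at position i.

min : ℕ → ℕ → ℕ
min zero _ = zero
min (suc _) zero = zero
min (suc a) (suc b) = suc (min a b)

Valleyless : ∀ {n} → (Fin n → ℕ) → Set
Valleyless {n} s = ∀ (i j k : Fin n) → i < j → j < k → min (s i) (s k) ≤ s j

word : ∀ {n} → Permutation′ n → Fin n → ℕ
word π i = suc (toℕ (π ⟨$⟩ʳ i))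

inv : ∀ {n} → Permutation′ n → Fin n → ℕ
inv {n} π k =
  length (filter (λ i → (i <? (π ⟨$⟩ˡ k)) ×-dec (k <? (π ⟨$⟩ʳ i))) (allFin n))

{-# OPTIONS --safe #-}
-- Let v sit at position p = π⁻¹ v.  Every entry larger than v lies either
-- left of p (there are a_v = inv π v of them) or right of p (say b_v of
-- them), and with 0-based values there are n − 1 − v larger entries in all,
-- so a_v + b_v = n − 1 − v.  A valley is an entry with a larger entry on
-- each side, so π is valleyless iff a_v = 0 or b_v = 0 for every v, that
-- is, iff a_v ∈ {0, n − 1 − v}.
module Submission where

open import Defs
open import Data.Nat using (ℕ; zero; suc; _∸_; _≤_; _<_; _+_; _⊓_; s<s; s<s⁻¹)
import Data.Nat.Properties as ℕ
open import Data.Fin as Fin using (Fin; zero; suc; toℕ)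
import Data.Fin.Properties as Finₚ
open import Data.Fin.Permutation using (Permutation′; _⟨$⟩ʳ_; _⟨$⟩ˡ_; inverseˡ; inverseʳ)
open import Data.List using (length; filter; allFin; tabulate)
open import Data.List.Properties using (filter-some; filter-none)
import Data.List.Relation.Unary.All.Properties as All
import Data.List.Relation.Unary.Any.Properties as Any
open import Data.Product using (_×_; _,_; proj₂)
open import Data.Sum using (_⊎_; inj₁; inj₂; [_,_])
open import Data.Sum.Function.Propositional using (_⊎-⇔_)
open import Data.Empty using (⊥-elim)
open import Data.Bool using (if_then_else_)
open import Function using (_∘_; _⇔_; mk⇔; Equivalence)
open import Function.Construct.Composition using (_⇔-∘_)
open import Function.Construct.Symmetry using (⇔-sym)
open import Function.Construct.Identity using (⇔-id)
open import Level using (Level; 0ℓ)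
open import Relation.Nullary using (Dec; yes; no; does; ¬_)
open import Relation.Nullary.Decidable using (_×-dec_)
open import Relation.Unary using (Pred; Decidable)
open import Relation.Binary using (tri<; tri≈; tri>)
open import Relation.Binary.PropositionalEquality
  using (_≡_; refl; sym; trans; cong; cong₂; subst; module ≡-Reasoning)
open import Algebra.Properties.CommutativeMonoid.Sum ℕ.+-0-commutativeMonoid
  using (sum; sum-cong-≗; sum-permute; ∑-distrib-+)

private variable
  a b p q r : Level
  A : Set a
  n : ℕ

∀-⇔ : {B C : A → Set b} → (∀ x → B x ⇔ C x) → (∀ x → B x) ⇔ (∀ x → C x)
∀-⇔ B⇔C = mk⇔ (λ B x → Equivalence.to (B⇔C x) (B x)) (λ C x → Equivalence.from (B⇔C x) (C x))

m+n≡o⇒n≡0⇔m≡o : ∀ {m n o} → m + n ≡ o → (n ≡ 0) ⇔ (m ≡ o)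
m+n≡o⇒n≡0⇔m≡o {m} {n} refl = mk⇔
  (λ { refl → sym (ℕ.+-identityʳ m) })
  (λ m≡m+n → ℕ.+-cancelˡ-≡ m n 0 (trans (sym m≡m+n) (sym (ℕ.+-identityʳ m))))

𝟙 : {P : Set p} → Dec P → ℕ
𝟙 P? = if does P? then 1 else 0

𝟙-⊎ : {P : Set p} {Q : Set q} {R : Set r} → P ⇔ (Q ⊎ R) → ¬ (Q × R) →
      (P? : Dec P) (Q? : Dec Q) (R? : Dec R) → 𝟙 P? ≡ 𝟙 Q? + 𝟙 R?
𝟙-⊎ P⇔Q⊎R ¬Q×R (yes _) (yes q) (yes r) = ⊥-elim (¬Q×R (q , r))
𝟙-⊎ P⇔Q⊎R ¬Q×R (yes _) (yes _) (no _)  = refl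
𝟙-⊎ P⇔Q⊎R ¬Q×R (yes _) (no _)  (yes _) = refl
𝟙-⊎ P⇔Q⊎R ¬Q×R (yes p) (no ¬q) (no ¬r) = ⊥-elim ([ ¬q , ¬r ] (Equivalence.to P⇔Q⊎R p))
𝟙-⊎ P⇔Q⊎R ¬Q×R (no ¬p) (yes q) _       = ⊥-elim (¬p (Equivalence.from P⇔Q⊎R (inj₁ q)))
𝟙-⊎ P⇔Q⊎R ¬Q×R (no ¬p) (no _)  (yes r) = ⊥-elim (¬p (Equivalence.from P⇔Q⊎R (inj₂ r)))
𝟙-⊎ P⇔Q⊎R ¬Q×R (no _)  (no _)  (no _)  = refl

count : {P : Pred (Fin n) p} → Decidable P → ℕ
count {n} P? = length (filter P? (allFin n))

length-filter-tabulate : {P : Pred A p} (P? : Decidable P) (f : Fin n → A) →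
                         length (filter P? (tabulate f)) ≡ sum (λ i → 𝟙 (P? (f i)))
length-filter-tabulate {n = zero}  P? f = refl
length-filter-tabulate {n = suc n} P? f with P? (f zero)
... | yes _ = cong suc (length-filter-tabulate P? (f ∘ suc))
... | no _  = length-filter-tabulate P? (f ∘ suc)

count≡sum : {P : Pred (Fin n) p} (P? : Decidable P) → count P? ≡ sum (λ i → 𝟙 (P? i))
count≡sum P? = length-filter-tabulate P? (λ i → i)

count≡0⇔ : {P : Pred (Fin n) p} (P? : Decidable P) → (count P? ≡ 0) ⇔ (∀ i → ¬ P i)
count≡0⇔ P? = mk⇔
  (λ count≡0 i Pi → ℕ.<-irrefl (sym count≡0) (filter-some P? (Any.tabulate⁺ i Pi)))
  (λ ∄P → cong length (filter-none P? (All.tabulate⁺ ∄P)))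

count-⊎ : {P : Pred (Fin n) p} {Q : Pred (Fin n) q} {R : Pred (Fin n) r}
          (P? : Decidable P) (Q? : Decidable Q) (R? : Decidable R) →
          (∀ i → P i ⇔ (Q i ⊎ R i)) → (∀ i → ¬ (Q i × R i)) →
          count P? ≡ count Q? + count R?
count-⊎ P? Q? R? P⇔Q⊎R ¬Q×R = begin
  count P?                                       ≡⟨ count≡sum P? ⟩
  sum (λ i → 𝟙 (P? i))                           ≡⟨ sum-cong-≗ (λ i → 𝟙-⊎ (P⇔Q⊎R i) (¬Q×R i) (P? i) (Q? i) (R? i)) ⟩
  sum (λ i → 𝟙 (Q? i) + 𝟙 (R? i))                ≡⟨ ∑-distrib-+ (λ i → 𝟙 (Q? i)) (λ i → 𝟙 (R? i)) ⟩
  sum (λ i → 𝟙 (Q? i)) + sum (λ i → 𝟙 (R? i))    ≡⟨ sym (cong₂ _+_ (count≡sum Q?) (count≡sum R?)) ⟩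
  count Q? + count R?                            ∎
  where open ≡-Reasoning

count-permute : {P : Pred (Fin n) p} (P? : Decidable P) (σ : Permutation′ n) →
                count (λ i → P? (σ ⟨$⟩ʳ i)) ≡ count P?
count-permute P? σ = begin
  count (λ i → P? (σ ⟨$⟩ʳ i))         ≡⟨ count≡sum (λ i → P? (σ ⟨$⟩ʳ i)) ⟩
  sum (λ i → 𝟙 (P? (σ ⟨$⟩ʳ i)))       ≡⟨ sum-permute (λ i → 𝟙 (P? i)) σ ⟨
  sum (λ i → 𝟙 (P? i))                ≡⟨ count≡sum P? ⟨
  count P?                            ∎
  where open ≡-Reasoning

count-greater : (v : Fin n) → count (λ (j : Fin n) → v Fin.<? j) ≡ n ∸ suc (toℕ v)
count-greater {n} v = trans (count≡sum (λ (j : Fin n) → v Fin.<? j)) (sum-greater v)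
  where
  sum-ones : ∀ n → sum {n} (λ _ → 1) ≡ n
  sum-ones zero    = refl
  sum-ones (suc n) = cong suc (sum-ones n)

  sum-greater : ∀ {n} (v : Fin n) → sum (λ (j : Fin n) → 𝟙 (v Fin.<? j)) ≡ n ∸ suc (toℕ v)
  sum-greater {suc n} zero = sum-ones n
  sum-greater (suc v)      = sum-greater v

count≡0⊎count≡0⇔ : {P : Pred (Fin n) p} {Q : Pred (Fin n) q} (P? : Decidable P) (Q? : Decidable Q) →
                   (count P? ≡ 0 ⊎ count Q? ≡ 0) ⇔ (∀ i j → P i → ¬ Q j)
count≡0⊎count≡0⇔ {P = P} {Q} P? Q? = mk⇔ to from
  where
  to : count P? ≡ 0 ⊎ count Q? ≡ 0 → ∀ i j → P i → ¬ Q j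
  to (inj₁ #P≡0) i _ Pi _  = Equivalence.to (count≡0⇔ P?) #P≡0 i Pi
  to (inj₂ #Q≡0) _ j _  Qj = Equivalence.to (count≡0⇔ Q?) #Q≡0 j Qj

  from : (∀ i j → P i → ¬ Q j) → count P? ≡ 0 ⊎ count Q? ≡ 0
  from P×Q→⊥ with count Q? ℕ.≟ 0
  ... | yes #Q≡0 = inj₂ #Q≡0
  ... | no  #Q≢0 = inj₁ (Equivalence.from (count≡0⇔ P?) λ i Pi →
                     #Q≢0 (Equivalence.from (count≡0⇔ Q?) λ j → P×Q→⊥ i j Pi))

min≡⊓ : ∀ x y → min x y ≡ x ⊓ y
min≡⊓ zero    y       = refl
min≡⊓ (suc x) zero    = refl
min≡⊓ (suc x) (suc y) = cong suc (min≡⊓ x y)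

min≤⇔ : ∀ x y z → min x y ≤ z ⇔ (¬ (z < x × z < y))
min≤⇔ x y z rewrite min≡⊓ x y = mk⇔
  (λ x⊓y≤z (z<x , z<y) → ℕ.<⇒≱ (ℕ.⊓-pres-m< z<x z<y) x⊓y≤z)
  (λ ¬z<x×z<y → ℕ.≮⇒≥ λ z<x⊓y → ¬z<x×z<y (ℕ.m<n⊓o⇒m<n x y z<x⊓y , ℕ.m<n⊓o⇒m<o x y z<x⊓y))

valleyless⇔ : (s : Fin n → ℕ) →
              Valleyless s ⇔ (∀ i j k → i Fin.< j → j Fin.< k → ¬ (s j < s i × s j < s k))
valleyless⇔ s = mk⇔
  (λ V i j k i<j j<k → Equivalence.to   (min≤⇔ (s i) (s k) (s j)) (V i j k i<j j<k))
  (λ V i j k i<j j<k → Equivalence.from (min≤⇔ (s i) (s k) (s j)) (V i j k i<j j<k))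

module _ (π : Permutation′ n) (v : Fin n) where

  LargerLeft LargerRight : Pred (Fin n) 0ℓ
  LargerLeft  i = i Fin.< π ⟨$⟩ˡ v × v Fin.< π ⟨$⟩ʳ i
  LargerRight i = π ⟨$⟩ˡ v Fin.< i × v Fin.< π ⟨$⟩ʳ i

  largerLeft? : Decidable LargerLeft
  largerLeft? i = (i Fin.<? π ⟨$⟩ˡ v) ×-dec (v Fin.<? π ⟨$⟩ʳ i)

  largerRight? : Decidable LargerRight
  largerRight? i = (π ⟨$⟩ˡ v Fin.<? i) ×-dec (v Fin.<? π ⟨$⟩ʳ i)

  invʳ : ℕ
  invʳ = count largerRight?

  larger⇔LargerLeft⊎LargerRight : ∀ i → v Fin.< π ⟨$⟩ʳ i ⇔ (LargerLeft i ⊎ LargerRight i)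
  larger⇔LargerLeft⊎LargerRight i = mk⇔ split [ proj₂ , proj₂ ]
    where
    split : v Fin.< π ⟨$⟩ʳ i → LargerLeft i ⊎ LargerRight i
    split v<πi with Finₚ.<-cmp i (π ⟨$⟩ˡ v)
    ... | tri< i<p _ _    = inj₁ (i<p , v<πi)
    ... | tri≈ _ refl _   = ⊥-elim (Finₚ.<-irrefl (sym (inverseʳ π)) v<πi)
    ... | tri> _ _ p<i    = inj₂ (p<i , v<πi)

  inv+invʳ≡n∸suc[v] : inv π v + invʳ ≡ n ∸ suc (toℕ v)
  inv+invʳ≡n∸suc[v] = begin
    inv π v + invʳ                          ≡⟨ count-⊎ _ largerLeft? largerRight?
                                                 larger⇔LargerLeft⊎LargerRight
                                                 (λ _ ((i<p , _) , (p<i , _)) → Finₚ.<-asym i<p p<i) ⟨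
    count (λ i → v Fin.<? π ⟨$⟩ʳ i)         ≡⟨ count-permute (λ (j : Fin n) → v Fin.<? j) π ⟩
    count (λ (j : Fin n) → v Fin.<? j)      ≡⟨ count-greater v ⟩
    n ∸ suc (toℕ v)                         ∎
    where open ≡-Reasoning

word-valleyless⇔ : (π : Permutation′ n) →
                   Valleyless (word π) ⇔ (∀ v i k → LargerLeft π v i → ¬ LargerRight π v k)
word-valleyless⇔ π = mk⇔ to from ⇔-∘ valleyless⇔ (word π)
  where
  to : (∀ i j k → i Fin.< j → j Fin.< k → ¬ (word π j < word π i × word π j < word π k)) →
       ∀ v i k → LargerLeft π v i → ¬ LargerRight π v k
  to V v i k (i<p , v<πi) (p<k , v<πk) = V i (π ⟨$⟩ˡ v) k i<p p<k (above v<πi , above v<πk)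
    where
    above : ∀ {x} → v Fin.< π ⟨$⟩ʳ x → word π (π ⟨$⟩ˡ v) < word π x
    above {x} v<πx = s<s (subst (Fin._< π ⟨$⟩ʳ x) (sym (inverseʳ π)) v<πx)

  from : (∀ v i k → LargerLeft π v i → ¬ LargerRight π v k) →
         ∀ i j k → i Fin.< j → j Fin.< k → ¬ (word π j < word π i × word π j < word π k)
  from H i j k i<j j<k (πj<πi , πj<πk) =
    H (π ⟨$⟩ʳ j) i k (subst (i Fin.<_) (sym (inverseˡ π)) i<j , s<s⁻¹ πj<πi)
                     (subst (Fin._< k) (sym (inverseˡ π)) j<k , s<s⁻¹ πj<πk)

theorem2 : (n : ℕ) → 0 < n → (π : Permutation′ n) →
    Valleyless (word π) ⇔ (∀ (k : Fin n) → inv π k ≡ 0 ⊎ inv π k ≡ n ∸ suc (toℕ k))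
theorem2 n _ π = ∀-⇔ inv-dichotomy ⇔-∘ word-valleyless⇔ π
  where
  inv-dichotomy : ∀ v → (∀ i k → LargerLeft π v i → ¬ LargerRight π v k) ⇔
                        (inv π v ≡ 0 ⊎ inv π v ≡ n ∸ suc (toℕ v))
  inv-dichotomy v = (⇔-id _ ⊎-⇔ m+n≡o⇒n≡0⇔m≡o (inv+invʳ≡n∸suc[v] π v))
                ⇔-∘ ⇔-sym (count≡0⊎count≡0⇔ (largerLeft? π v) (largerRight? π v))
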